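{- For $m\ge 3$ and $n\geq 2$, the chromatic polynomial of the signed book graph $B^{uv}(m,n)=(B(m,n),\{uv\})$ satisfies \[\chi_{B^{uv}(m,n)}(\lambda)=(\lambda-1)\gamma_{m-1}\chi_{B^{uv}(m,n-1)}(\lambda)+(-1)^{m-2}(\lambda-1)^2\gamma_m^{n-1}\] and equals \[(\lambda-1)^{m+n-1}\gamma_{m-1}^{n-1}+(-1)^{m-2}\gamma_m(\lambda-1)^2\frac{(\lambda-1)^{n-1}\gamma_{m-1}^{n-1}-\gamma_m^{n-1}}{(\lambda-1)\gamma_{m-1}-\gamma_m},\] where $\gamma_j=\frac{(\lambda-1)^{j-1}-(-1)^{j-1}}{\lambda}$ for $j\ge 2$.
   Context: The book graph $B(m,n)$ has vertices $\{u,v\}\cup\{u_j^i:1\le i\le n,1\le j\le m-2\}$ and consists of the $n$ cycles $uu_1^i\cdots u_{m-2}^ivu$ sharing the edge $uv$. $B^{uv}(m,n)$ is the signed graph on $B(m,n)$ in which $uv$ is the only negative edge. For a signed graph with sign function $\sigma$, a proper coloring with colors $\{ -k,\ldots,0,\ldots,k\}$ is a map $c$ with $c(x)\ne\sigma(e)c(y)$ for each edge $e=xy$; the chromatic polynomial is the polynomial whose value at $\lambda=2k+1$ counts proper colorings. -}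

module Defs where

open import Data.Nat as ℕ using (ℕ; zero; suc; _∸_)
open import Data.Fin as Fin using (Fin; zero; suc; _↑ʳ_; combine; inject₁; fromℕ)
open import Data.Integer as ℤ using (ℤ; +_)
open import Data.Rational as ℚ using (ℚ; 0ℚ; 1ℚ; _÷_; ≢-nonZero)
open import Data.Rational.Properties using () renaming (_≟_ to _≟ℚ_)
open import Data.List using (List; []; _∷_; _++_; map; concatMap; concat; length; filter; allFin)
open import Data.List.Relation.Unary.All using (All; all?)
open import Data.Vec using (Vec; []; _∷_; lookup)
open import Data.Product using (_×_; _,_)
open import Relation.Nullary using (¬_; Dec; yes; no; ¬?)
open import Relation.Binary.PropositionalEquality using (_≡_)

data Sign : Set where
  pos neg : Sign

_·_ : Sign → ℤ → ℤ
pos · x = x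
neg · x = ℤ.- x

record SignedGraph : Set where
  constructor mkSG
  field
    V     : ℕ
    edges : List (Fin V × Fin V × Sign)
open SignedGraph public

-- Colour set {-k,…,0,…,k}: index i : Fin (2k+1) denotes the integer i - k.
colour : (k : ℕ) → Fin (suc (2 ℕ.* k)) → ℤ
colour k i = + Fin.toℕ i ℤ.- + k

allMaps : (c N : ℕ) → List (Vec (Fin c) N)
allMaps c zero    = [] ∷ []
allMaps c (suc N) = concatMap (λ i → map (i ∷_) (allMaps c N)) (allFin c)

Proper : (G : SignedGraph) (k : ℕ) → Vec (Fin (suc (2 ℕ.* k))) (V G) → Set
Proper G k c =
  All (λ { (x , y , s) → ¬ (colour k (lookup c x) ≡ s · colour k (lookup c y)) }) (edges G)

proper? : (G : SignedGraph) (k : ℕ) → (c : Vec (Fin (suc (2 ℕ.* k))) (V G)) → Dec (Proper G k c)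
proper? G k c =
  all? (λ { (x , y , s) → ¬? (colour k (lookup c x) ℤ.≟ s · colour k (lookup c y)) }) (edges G)

-- Number of proper colourings with colours {-k,…,k}; this is the value of the
-- chromatic polynomial at λ = 2k+1.
χ : SignedGraph → ℕ → ℕ
χ G k = length (filter (proper? G k) (allMaps (suc (2 ℕ.* k)) (V G)))

-- The signed book graph B^{uv}(m,n)
-- Vertices: u = 0, v = 1, u^i_j = 2 + i*(m-2) + j  (i : Fin n, j : Fin (m-2)).

module _ (n L : ℕ) where
  -- L = m - 2 = number of internal vertices of each page
  private
    Vt = Fin (2 ℕ.+ n ℕ.* L)

  bu bv : Vt
  bu = zero
  bv = suc zero

  bw : Fin n → Fin L → Vt
  bw i j = 2 ↑ʳ combine i j

pageEdges : (n L : ℕ) → Fin n → List (Fin (2 ℕ.+ n ℕ.* L) × Fin (2 ℕ.+ n ℕ.* L) × Sign)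
pageEdges n zero      i = (bu n 0 , bv n 0 , pos) ∷ []
pageEdges n (suc L') i =
  (bu n (suc L') , bw n (suc L') i zero , pos)
  ∷ (map (λ j → (bw n (suc L') i (inject₁ j) , bw n (suc L') i (suc j) , pos)) (allFin L')
     ++ ((bw n (suc L') i (fromℕ L') , bv n (suc L') , pos) ∷ []))

signedBook : (m n : ℕ) → SignedGraph
signedBook m n =
  mkSG (2 ℕ.+ n ℕ.* (m ∸ 2))
       ((bu n (m ∸ 2) , bv n (m ∸ 2) , neg) ∷ concatMap (pageEdges n (m ∸ 2)) (allFin n))

infixr 8 _^_
_^_ : ℚ → ℕ → ℚ
p ^ zero  = 1ℚ
p ^ suc n = p ℚ.* (p ^ n)

-- total division (p / 0 := 0); only used where the denominator is nonzero
infixl 7 _÷₀_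
_÷₀_ : ℚ → ℚ → ℚ
p ÷₀ q with q ≟ℚ 0ℚ
... | yes _  = 0ℚ
... | no q≢0 = _÷_ p q {{≢-nonZero q≢0}}

lam : ℕ → ℚ
lam k = + suc (2 ℕ.* k) ℚ./ 1

γ : ℕ → ℕ → ℚ
γ k j = ((lam k ℚ.- 1ℚ) ^ (j ∸ 1) ℚ.- (ℚ.- 1ℚ) ^ (j ∸ 1)) ÷₀ lam k

χℚ : SignedGraph → ℕ → ℚ
χℚ G k = + χ G k ℚ./ 1

{-# OPTIONS --safe #-}
module Submission where

-- Colour u and v first, say by a and b.  The pages are then coloured independently, each
-- by a walk of length m - 1 from a to b in the complete graph on the λ colours; there are
-- γ_m - δ_ab (-1)^(m-2) of these.  The negative edge uv excludes exactly the pairs with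
-- b = -a, and a = -a only for a = 0, so summing over the colour pairs gives
--   χ_{B^{uv}(m,n)} = (λ-1) ((λ-1) γ_{m-1})^n + (λ-1)^2 γ_m^n,
-- using (λ-1) γ_{m-1} = γ_m - (-1)^(m-2).  Both identities follow: the first directly,
-- the second by solving that first-order linear recurrence in n from χ_{B^{uv}(m,1)} = (λ-1)^m.

open import Algebra.Bundles using (Monoid; CommutativeRing)
open import Data.Fin as Fin using (Fin; zero; suc; toℕ; fromℕ<; combine; inject₁; fromℕ; opposite)
import Data.Fin.Properties as FinP
open import Data.Integer as ℤ using (ℤ)
import Data.Integer.Properties as ℤP
open import Data.Integer.Tactic.RingSolver using (solve-∀)
open import Data.List using (List; []; _∷_; _++_; map; concatMap; foldr; tabulate; allFin; filter; length)
open import Data.List.Relation.Unary.All using (all?)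
open import Data.Bool using (true; false; if_then_else_)
open import Data.Nat as ℕ using (ℕ; zero; suc; _≤_; _∸_; s≤s) renaming (_+_ to _+ℕ_)
import Data.Nat.Properties as ℕP
import Data.Nat.Coprimality as Coprime
open import Data.Product using (_×_; _,_)
open import Data.Rational as ℚ using (ℚ; mkℚ; 0ℚ; 1ℚ; _+_; _-_; _*_; -_)
import Data.Rational.Properties as ℚP
import Data.Rational.Unnormalised as ℚᵘ
import Data.Rational.Unnormalised.Properties as ℚᵘP
open import Data.Rational.Solver using (module +-*-Solver)
open import Data.Vec as Vec using (Vec; []; _∷_; lookup)
import Data.Vec.Properties as VecP
open import Function using (_∘_; _⇔_; mk⇔)
open import Relation.Nullary using (Dec; yes; no; does; ¬?; contradiction)
open import Relation.Nullary.Decidable using (does-⇔)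
open import Relation.Unary using (Decidable)
open import Relation.Binary.PropositionalEquality
open import Defs

open +-*-Solver using (solve; _:=_; _:+_; _:*_; _:-_; :-_; con)
open ≡-Reasoning

module ListFold {c ℓ} (M : Monoid c ℓ) where
  open Monoid M using (Carrier; _≈_; _∙_; ε; ∙-cong; ∙-congˡ; assoc; identityˡ)
    renaming (refl to ≈-refl; sym to ≈-sym; trans to ≈-trans)
  open import Algebra.Properties.Monoid.Sum M using (sum)

  foldMap : {A : Set} → (A → Carrier) → List A → Carrier
  foldMap f = foldr (λ x acc → f x ∙ acc) ε

  foldMap-cong : {A : Set} {f g : A → Carrier} → (∀ x → f x ≈ g x) → ∀ xs → foldMap f xs ≈ foldMap g xs
  foldMap-cong f≈g []       = ≈-refl
  foldMap-cong f≈g (x ∷ xs) = ∙-cong (f≈g x) (foldMap-cong f≈g xs)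

  foldMap-++ : {A : Set} (f : A → Carrier) (xs ys : List A) → foldMap f (xs ++ ys) ≈ foldMap f xs ∙ foldMap f ys
  foldMap-++ f []       ys = ≈-sym (identityˡ _)
  foldMap-++ f (x ∷ xs) ys = ≈-trans (∙-congˡ (foldMap-++ f xs ys)) (≈-sym (assoc _ _ _))

  foldMap-concatMap : {A B : Set} (f : B → Carrier) (g : A → List B) (xs : List A) →
                      foldMap f (concatMap g xs) ≈ foldMap (foldMap f ∘ g) xs
  foldMap-concatMap f g []       = ≈-refl
  foldMap-concatMap f g (x ∷ xs) = ≈-trans (foldMap-++ f (g x) _) (∙-congˡ (foldMap-concatMap f g xs))

  foldMap-map : {A B : Set} (f : B → Carrier) (g : A → B) (xs : List A) → foldMap f (map g xs) ≡ foldMap (f ∘ g) xs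
  foldMap-map f g []       = refl
  foldMap-map f g (x ∷ xs) = cong (f (g x) ∙_) (foldMap-map f g xs)

  foldMap-tabulate : {A : Set} {n : ℕ} (f : A → Carrier) (g : Fin n → A) → foldMap f (tabulate g) ≡ sum (f ∘ g)
  foldMap-tabulate {n = zero}  f g = refl
  foldMap-tabulate {n = suc n} f g = cong (f (g zero) ∙_) (foldMap-tabulate f (g ∘ suc))

open import Algebra.Properties.Semiring.Sum (CommutativeRing.semiring ℚP.+-*-commutativeRing) using (sum; sum-syntax; ∑-distrib-+; sum-cong-≗)
open import Algebra.Properties.Monoid.Sum ℚP.*-1-monoid using () renaming (sum to product; sum-cong-≗ to sum-cong-≗ᴾ)

module Sumˡ = ListFold ℚP.+-0-monoid
module Prodˡ = ListFold ℚP.*-1-monoid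

∑ˡ ∏ˡ : {A : Set} → (A → ℚ) → List A → ℚ
∑ˡ = Sumˡ.foldMap
∏ˡ = Prodˡ.foldMap

∑ˡ-*ˡ : {A : Set} (r : ℚ) (f : A → ℚ) (xs : List A) → ∑ˡ (λ x → r * f x) xs ≡ r * ∑ˡ f xs
∑ˡ-*ˡ r f []       = sym (ℚP.*-zeroʳ r)
∑ˡ-*ˡ r f (x ∷ xs) = trans (cong ((r * f x) +_) (∑ˡ-*ˡ r f xs)) (sym (ℚP.*-distribˡ-+ r (f x) _))

∑ˡ-*ʳ : {A : Set} (r : ℚ) (f : A → ℚ) (xs : List A) → ∑ˡ (λ x → f x * r) xs ≡ ∑ˡ f xs * r
∑ˡ-*ʳ r f xs = begin
  ∑ˡ (λ x → f x * r) xs ≡⟨ Sumˡ.foldMap-cong (λ x → ℚP.*-comm (f x) r) xs ⟩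
  ∑ˡ (λ x → r * f x) xs ≡⟨ ∑ˡ-*ˡ r f xs ⟩
  r * ∑ˡ f xs           ≡⟨ ℚP.*-comm r _ ⟩
  ∑ˡ f xs * r           ∎

ι : ℕ → ℚ
ι n = ℤ.+ n ℚ./ 1

-- The normal form of ι n, on which the operations of ℚ compute.
ι′ : ℕ → ℚ
ι′ n = mkℚ (ℤ.+ n) 0 (Coprime.sym (Coprime.1-coprimeTo n))

ι≡ι′ : ∀ n → ι n ≡ ι′ n
ι≡ι′ n = ℚP.↥p/↧p≡p (ι′ n)

ι-suc : ∀ n → ι (suc n) ≡ 1ℚ + ι n
ι-suc n = begin
  ι (suc n)   ≡⟨ ι≡ι′ (suc n) ⟩
  ι′ (suc n)  ≡⟨ ℚP.toℚᵘ-injective (ℚᵘP.≃-trans (ℚᵘ.*≡* numerators) (ℚᵘP.≃-sym (ℚP.toℚᵘ-homo-+ 1ℚ (ι′ n)))) ⟩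
  1ℚ + ι′ n   ≡⟨ cong (1ℚ +_) (ι≡ι′ n) ⟨
  1ℚ + ι n    ∎
  where
  numerators : ℤ.+ suc n ℤ.* ℤ.+ 1 ≡ (ℤ.+ 1 ℤ.* ℤ.+ 1 ℤ.+ ℤ.+ n ℤ.* ℤ.+ 1) ℤ.* ℤ.+ 1
  numerators = cong (ℤ._* ℤ.+ 1) (trans (ℤP.pos-+ 1 n) (cong (ℤ._+_ (ℤ.+ 1)) (sym (ℤP.*-identityʳ (ℤ.+ n)))))

ι-suc≢0 : ∀ n → ι (suc n) ≢ 0ℚ
ι-suc≢0 n eq with trans (sym (ι≡ι′ (suc n))) eq
... | ()

⟦_⟧ : {P : Set} → Dec P → ℚ
⟦ P? ⟧ = if does P? then 1ℚ else 0ℚ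

⟦¬?⟧ : {P : Set} (P? : Dec P) → ⟦ ¬? P? ⟧ ≡ 1ℚ - ⟦ P? ⟧
⟦¬?⟧ (yes _) = refl
⟦¬?⟧ (no _)  = refl

⟦⟧-⇔ : {P Q : Set} → P ⇔ Q → (P? : Dec P) (Q? : Dec Q) → ⟦ P? ⟧ ≡ ⟦ Q? ⟧
⟦⟧-⇔ P⇔Q P? Q? = cong (λ b → if b then 1ℚ else 0ℚ) (does-⇔ P⇔Q P? Q?)

ι-length-filter : {A : Set} {P : A → Set} (P? : Decidable P) (xs : List A) →
                  ι (length (filter P? xs)) ≡ ∑ˡ (λ x → ⟦ P? x ⟧) xs
ι-length-filter P? []       = refl
ι-length-filter P? (x ∷ xs) with does (P? x)
... | true  = trans (ι-suc (length (filter P? xs))) (cong (1ℚ +_) (ι-length-filter P? xs))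
... | false = trans (ι-length-filter P? xs) (sym (ℚP.+-identityˡ (∑ˡ (λ x → ⟦ P? x ⟧) xs)))

⟦all?⟧ : {A : Set} {P : A → Set} (P? : Decidable P) (xs : List A) → ⟦ all? P? xs ⟧ ≡ ∏ˡ (λ x → ⟦ P? x ⟧) xs
⟦all?⟧ P? []       = refl
⟦all?⟧ P? (x ∷ xs) with does (P? x)
... | true  = trans (⟦all?⟧ P? xs) (sym (ℚP.*-identityˡ (∏ˡ (λ x → ⟦ P? x ⟧) xs)))
... | false = sym (ℚP.*-zeroˡ (∏ˡ (λ x → ⟦ P? x ⟧) xs))

δ : {n : ℕ} → Fin n → Fin n → ℚ
δ a b = ⟦ a FinP.≟ b ⟧

δ-sym : {n : ℕ} (a b : Fin n) → δ a b ≡ δ b a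
δ-sym a b = ⟦⟧-⇔ (mk⇔ sym sym) (a FinP.≟ b) (b FinP.≟ a)

∑-const : (n : ℕ) (x : ℚ) → ∑[ i < n ] x ≡ ι n * x
∑-const zero    x = sym (ℚP.*-zeroˡ x)
∑-const (suc n) x = begin
  x + ∑[ i < n ] x   ≡⟨ cong (x +_) (∑-const n x) ⟩
  x + ι n * x        ≡⟨ solve 2 (λ x m → x :+ m :* x := (con 1ℚ :+ m) :* x) refl x (ι n) ⟩
  (1ℚ + ι n) * x     ≡⟨ cong (_* x) (ι-suc n) ⟨
  ι (suc n) * x      ∎

∑-δ : {n : ℕ} (a : Fin n) (f : Fin n → ℚ) → ∑[ w < n ] (δ a w * f w) ≡ f a
∑-δ {suc n} zero    f = begin
  1ℚ * f zero + ∑[ w < n ] (0ℚ * f (suc w)) ≡⟨ cong₂ _+_ (ℚP.*-identityˡ (f zero)) (sum-cong-≗ (λ w → ℚP.*-zeroˡ (f (suc w)))) ⟩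
  f zero + ∑[ w < n ] 0ℚ                   ≡⟨ cong (f zero +_) (trans (∑-const n 0ℚ) (ℚP.*-zeroʳ (ι n))) ⟩
  f zero + 0ℚ                              ≡⟨ ℚP.+-identityʳ (f zero) ⟩
  f zero                                   ∎
∑-δ {suc n} (suc a) f = trans (cong₂ _+_ (ℚP.*-zeroˡ (f zero)) (∑-δ a (f ∘ suc))) (ℚP.+-identityˡ (f (suc a)))

∑-affine-δ : {n : ℕ} (a : Fin n) (x y : ℚ) → ∑[ w < n ] (x + y * δ a w) ≡ ι n * x + y
∑-affine-δ {n} a x y = begin
  ∑[ w < n ] (x + y * δ a w)          ≡⟨ ∑-distrib-+ (λ _ → x) (λ w → y * δ a w) ⟩
  ∑[ w < n ] x + ∑[ w < n ] (y * δ a w) ≡⟨ cong₂ _+_ (∑-const n x) (trans (sum-cong-≗ (λ w → ℚP.*-comm y (δ a w))) (∑-δ a (λ _ → y))) ⟩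
  ι n * x + y                          ∎

∑-bilinear-δ : {n : ℕ} (a e : Fin n) (x y z t : ℚ) →
  ∑[ w < n ] ((x + y * δ a w) * (z + t * δ e w)) ≡ ι n * x * z + x * t + y * z + y * t * δ a e
∑-bilinear-δ {n} a e x y z t = begin
  ∑[ w < n ] ((x + y * δ a w) * (z + t * δ e w))
    ≡⟨ sum-cong-≗ expand ⟩
  ∑[ w < n ] ((x * z + y * z * δ a w) + δ e w * (x * t + y * t * δ a w))
    ≡⟨ ∑-distrib-+ (λ w → x * z + y * z * δ a w) (λ w → δ e w * (x * t + y * t * δ a w)) ⟩
  ∑[ w < n ] (x * z + y * z * δ a w) + ∑[ w < n ] (δ e w * (x * t + y * t * δ a w))
    ≡⟨ cong₂ _+_ (∑-affine-δ a (x * z) (y * z)) (∑-δ e (λ w → x * t + y * t * δ a w)) ⟩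
  ι n * (x * z) + y * z + (x * t + y * t * δ a e)
    ≡⟨ solve 6 (λ m x y z t d → m :* (x :* z) :+ y :* z :+ (x :* t :+ y :* t :* d)
                              := m :* x :* z :+ x :* t :+ y :* z :+ y :* t :* d) refl (ι n) x y z t (δ a e) ⟩
  ι n * x * z + x * t + y * z + y * t * δ a e ∎
  where
  expand : ∀ w → (x + y * δ a w) * (z + t * δ e w) ≡ (x * z + y * z * δ a w) + δ e w * (x * t + y * t * δ a w)
  expand w = solve 6 (λ x y z t p q → (x :+ y :* p) :* (z :+ t :* q)
                                   := (x :* z :+ y :* z :* p) :+ q :* (x :* t :+ y :* t :* p)) refl x y z t (δ a w) (δ e w)

÷₀-unique : {q x y : ℚ} → q ≢ 0ℚ → q * y ≡ x → x ÷₀ q ≡ y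
÷₀-unique {q} {x} {y} q≢0 refl with q ℚP.≟ 0ℚ
... | yes q≡0 = contradiction q≡0 q≢0
... | no q≢0′ = begin
  q * y * ℚ.1/ q   ≡⟨ solve 3 (λ q y r → q :* y :* r := y :* (q :* r)) refl q y (ℚ.1/ q) ⟩
  y * (q * ℚ.1/ q) ≡⟨ cong (y *_) (ℚP.*-inverseʳ q) ⟩
  y * 1ℚ           ≡⟨ ℚP.*-identityʳ y ⟩
  y                ∎
  where instance _ = ℚ.≢-nonZero q≢0′

*-÷₀ : {q : ℚ} (x : ℚ) → q ≢ 0ℚ → q * (x ÷₀ q) ≡ x
*-÷₀ {q} x q≢0 with q ℚP.≟ 0ℚ
... | yes q≡0 = contradiction q≡0 q≢0
... | no q≢0′ = begin
  q * (x * ℚ.1/ q) ≡⟨ solve 3 (λ q x r → q :* (x :* r) := x :* (q :* r)) refl q x (ℚ.1/ q) ⟩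
  x * (q * ℚ.1/ q) ≡⟨ cong (x *_) (ℚP.*-inverseʳ q) ⟩
  x * 1ℚ           ≡⟨ ℚP.*-identityʳ x ⟩
  x                ∎
  where instance _ = ℚ.≢-nonZero q≢0′

^-homo-* : (x : ℚ) (m n : ℕ) → x ^ (m +ℕ n) ≡ x ^ m * x ^ n
^-homo-* x zero    n = sym (ℚP.*-identityˡ (x ^ n))
^-homo-* x (suc m) n = trans (cong (x *_) (^-homo-* x m n)) (sym (ℚP.*-assoc x (x ^ m) (x ^ n)))

^-distrib-* : (x y : ℚ) (n : ℕ) → (x * y) ^ n ≡ x ^ n * y ^ n
^-distrib-* x y zero    = refl
^-distrib-* x y (suc n) = begin
  x * y * (x * y) ^ n       ≡⟨ cong (x * y *_) (^-distrib-* x y n) ⟩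
  x * y * (x ^ n * y ^ n)   ≡⟨ solve 4 (λ x y a b → x :* y :* (a :* b) := x :* a :* (y :* b)) refl x y (x ^ n) (y ^ n) ⟩
  x * x ^ n * (y * y ^ n)   ∎

-1^-square : (n : ℕ) → (- 1ℚ) ^ n * (- 1ℚ) ^ n ≡ 1ℚ
-1^-square zero    = refl
-1^-square (suc n) = trans (solve 1 (λ s → (:- con 1ℚ) :* s :* ((:- con 1ℚ) :* s) := s :* s) refl ((- 1ℚ) ^ n)) (-1^-square n)

-1^≢0 : (n : ℕ) → (- 1ℚ) ^ n ≢ 0ℚ
-1^≢0 n s≡0 with trans (sym (-1^-square n)) (cong (λ s → s * s) s≡0)
... | ()

^-δ : {P : Set} (P? : Dec P) (x y : ℚ) (n : ℕ) → (x - ⟦ P? ⟧ * y) ^ n ≡ x ^ n + ⟦ P? ⟧ * ((x - y) ^ n - x ^ n)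
^-δ (yes _) x y n = trans (cong (_^ n) (solve 2 (λ x y → x :- con 1ℚ :* y := x :- y) refl x y))
                          (solve 2 (λ a b → a := b :+ con 1ℚ :* (a :- b)) refl ((x - y) ^ n) (x ^ n))
^-δ (no _)  x y n = trans (cong (_^ n) (solve 2 (λ x y → x :- con 0ℚ :* y := x) refl x y))
                          (solve 2 (λ a b → b := b :+ con 0ℚ :* (a :- b)) refl ((x - y) ^ n) (x ^ n))

geometric : ℚ → ℚ → ℕ → ℚ
geometric r q zero    = 0ℚ
geometric r q (suc n) = r * geometric r q n + q ^ n

*-geometric : (r q : ℚ) (n : ℕ) → (r - q) * geometric r q n ≡ r ^ n - q ^ n
*-geometric r q zero    = solve 2 (λ r q → (r :- q) :* con 0ℚ := con 1ℚ :- con 1ℚ) refl r q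
*-geometric r q (suc n) = begin
  (r - q) * (r * geometric r q n + q ^ n)
    ≡⟨ solve 4 (λ r q g b → (r :- q) :* (r :* g :+ b) := r :* ((r :- q) :* g) :+ (r :- q) :* b) refl r q (geometric r q n) (q ^ n) ⟩
  r * ((r - q) * geometric r q n) + (r - q) * q ^ n
    ≡⟨ cong (λ g → r * g + (r - q) * q ^ n) (*-geometric r q n) ⟩
  r * (r ^ n - q ^ n) + (r - q) * q ^ n
    ≡⟨ solve 4 (λ r q a b → r :* (a :- b) :+ (r :- q) :* b := r :* a :- q :* b) refl r q (r ^ n) (q ^ n) ⟩
  r * r ^ n - q * q ^ n ∎

p-q≡0⇒p≡q : {p q : ℚ} → p - q ≡ 0ℚ → p ≡ q
p-q≡0⇒p≡q {p} {q} p-q≡0 = begin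
  p           ≡⟨ solve 2 (λ p q → p := (p :- q) :+ q) refl p q ⟩
  p - q + q   ≡⟨ cong (_+ q) p-q≡0 ⟩
  0ℚ + q      ≡⟨ ℚP.+-identityˡ q ⟩
  q           ∎

geometric≡÷₀ : {r q : ℚ} → r ≢ q → (n : ℕ) → geometric r q n ≡ (r ^ n - q ^ n) ÷₀ (r - q)
geometric≡÷₀ {r} {q} r≢q n = sym (÷₀-unique (r≢q ∘ p-q≡0⇒p≡q) (*-geometric r q n))

linear-recurrence : (x : ℕ → ℚ) (r t q : ℚ) → (∀ n → x (suc (suc n)) ≡ r * x (suc n) + t * q ^ suc n) →
                    ∀ n → x (suc n) ≡ r ^ n * x 1 + t * q * geometric r q n
linear-recurrence x r t q step zero    = solve 3 (λ a t q → a := con 1ℚ :* a :+ t :* q :* con 0ℚ) refl (x 1) t q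
linear-recurrence x r t q step (suc n) = begin
  x (suc (suc n))
    ≡⟨ step n ⟩
  r * x (suc n) + t * q ^ suc n
    ≡⟨ cong (λ y → r * y + t * q ^ suc n) (linear-recurrence x r t q step n) ⟩
  r * (r ^ n * x 1 + t * q * geometric r q n) + t * (q * q ^ n)
    ≡⟨ solve 7 (λ r t q a rn qn g → r :* (rn :* a :+ t :* q :* g) :+ t :* (q :* qn)
                                  := r :* rn :* a :+ t :* q :* (r :* g :+ qn)) refl r t q (x 1) (r ^ n) (q ^ n) (geometric r q n) ⟩
  r * r ^ n * x 1 + t * q * (r * geometric r q n + q ^ n) ∎

-- The i-th page of ws, laid out as the inner vertices bw i j of Defs.
block : {A : Set} {L : ℕ} (n : ℕ) → Fin n → Vec A (n ℕ.* L) → Vec A L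
block n i ws = Vec.tabulate (λ j → lookup ws (combine i j))

∑-allMaps-suc : (c N : ℕ) (f : Vec (Fin c) (suc N) → ℚ) →
                ∑ˡ f (allMaps c (suc N)) ≡ ∑[ a < c ] ∑ˡ (λ v → f (a ∷ v)) (allMaps c N)
∑-allMaps-suc c N f = begin
  ∑ˡ f (concatMap (λ a → map (a ∷_) (allMaps c N)) (allFin c))
    ≡⟨ Sumˡ.foldMap-concatMap f (λ a → map (a ∷_) (allMaps c N)) (allFin c) ⟩
  ∑ˡ (λ a → ∑ˡ f (map (a ∷_) (allMaps c N))) (allFin c)
    ≡⟨ Sumˡ.foldMap-cong (λ a → Sumˡ.foldMap-map f (a ∷_) (allMaps c N)) (allFin c) ⟩
  ∑ˡ (λ a → ∑ˡ (λ v → f (a ∷ v)) (allMaps c N)) (allFin c)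
    ≡⟨ Sumˡ.foldMap-tabulate (λ a → ∑ˡ (λ v → f (a ∷ v)) (allMaps c N)) (λ a → a) ⟩
  ∑[ a < c ] ∑ˡ (λ v → f (a ∷ v)) (allMaps c N) ∎

∑-allMaps-+ : (c M N : ℕ) (f : Vec (Fin c) (M +ℕ N) → ℚ) →
              ∑ˡ f (allMaps c (M +ℕ N)) ≡ ∑ˡ (λ xs → ∑ˡ (λ ys → f (xs Vec.++ ys)) (allMaps c N)) (allMaps c M)
∑-allMaps-+ c zero    N f = sym (ℚP.+-identityʳ (∑ˡ f (allMaps c N)))
∑-allMaps-+ c (suc M) N f = begin
  ∑ˡ f (allMaps c (suc M +ℕ N))
    ≡⟨ ∑-allMaps-suc c (M +ℕ N) f ⟩
  ∑[ a < c ] ∑ˡ (λ v → f (a ∷ v)) (allMaps c (M +ℕ N))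
    ≡⟨ sum-cong-≗ (λ a → ∑-allMaps-+ c M N (λ v → f (a ∷ v))) ⟩
  ∑[ a < c ] ∑ˡ (λ xs → ∑ˡ (λ ys → f (a ∷ xs Vec.++ ys)) (allMaps c N)) (allMaps c M)
    ≡⟨ ∑-allMaps-suc c M (λ xs → ∑ˡ (λ ys → f (xs Vec.++ ys)) (allMaps c N)) ⟨
  ∑ˡ (λ xs → ∑ˡ (λ ys → f (xs Vec.++ ys)) (allMaps c N)) (allMaps c (suc M)) ∎

block-zero-++ : {A : Set} {L : ℕ} (n : ℕ) (xs : Vec A L) (ys : Vec A (n ℕ.* L)) → block (suc n) zero (xs Vec.++ ys) ≡ xs
block-zero-++ n xs ys = trans (VecP.tabulate-cong (VecP.lookup-++ˡ xs ys)) (VecP.tabulate∘lookup xs)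

block-suc-++ : {A : Set} {L : ℕ} (n : ℕ) (i : Fin n) (xs : Vec A L) (ys : Vec A (n ℕ.* L)) →
               block (suc n) (suc i) (xs Vec.++ ys) ≡ block n i ys
block-suc-++ n i xs ys = VecP.tabulate-cong (λ j → VecP.lookup-++ʳ xs ys (combine i j))

∑-blocks : (c L n : ℕ) (w : Vec (Fin c) L → ℚ) →
           ∑ˡ (λ ws → product (λ i → w (block n i ws))) (allMaps c (n ℕ.* L)) ≡ ∑ˡ w (allMaps c L) ^ n
∑-blocks c L zero    w = ℚP.+-identityʳ 1ℚ
∑-blocks c L (suc n) w = begin
  ∑ˡ (λ ws → product (λ i → w (block (suc n) i ws))) (allMaps c (L +ℕ n ℕ.* L))
    ≡⟨ ∑-allMaps-+ c L (n ℕ.* L) (λ ws → product (λ i → w (block (suc n) i ws))) ⟩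
  ∑ˡ (λ xs → ∑ˡ (λ ys → product (λ i → w (block (suc n) i (xs Vec.++ ys)))) (allMaps c (n ℕ.* L))) (allMaps c L)
    ≡⟨ Sumˡ.foldMap-cong (λ xs → Sumˡ.foldMap-cong (split xs) (allMaps c (n ℕ.* L))) (allMaps c L) ⟩
  ∑ˡ (λ xs → ∑ˡ (λ ys → w xs * product (λ i → w (block n i ys))) (allMaps c (n ℕ.* L))) (allMaps c L)
    ≡⟨ Sumˡ.foldMap-cong (λ xs → ∑ˡ-*ˡ (w xs) _ (allMaps c (n ℕ.* L))) (allMaps c L) ⟩
  ∑ˡ (λ xs → w xs * ∑ˡ (λ ys → product (λ i → w (block n i ys))) (allMaps c (n ℕ.* L))) (allMaps c L)
    ≡⟨ ∑ˡ-*ʳ _ w (allMaps c L) ⟩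
  ∑ˡ w (allMaps c L) * ∑ˡ (λ ys → product (λ i → w (block n i ys))) (allMaps c (n ℕ.* L))
    ≡⟨ cong (∑ˡ w (allMaps c L) *_) (∑-blocks c L n w) ⟩
  ∑ˡ w (allMaps c L) * ∑ˡ w (allMaps c L) ^ n ∎
  where
  split : ∀ xs ys → product (λ i → w (block (suc n) i (xs Vec.++ ys))) ≡ w xs * product (λ i → w (block n i ys))
  split xs ys = cong₂ _*_ (cong w (block-zero-++ n xs ys)) (sum-cong-≗ᴾ (λ i → cong w (block-suc-++ n i xs ys)))

-- Colourings of the signed book with the colours -k, …, k

i≡-i⇒i≡0 : {i : ℤ} → i ≡ ℤ.- i → i ≡ ℤ.0ℤ
i≡-i⇒i≡0 {i} i≡-i = ℤP.*-cancelˡ-≡ (ℤ.+ 2) i ℤ.0ℤ (begin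
  ℤ.+ 2 ℤ.* i   ≡⟨ double i ⟩
  i ℤ.+ i       ≡⟨ cong (ℤ._+_ i) i≡-i ⟩
  i ℤ.+ ℤ.- i   ≡⟨ ℤP.+-inverseʳ i ⟩
  ℤ.0ℤ          ∎)
  where
  double : ∀ i → ℤ.+ 2 ℤ.* i ≡ i ℤ.+ i
  double = solve-∀

module _ (k : ℕ) where

  colours : ℕ
  colours = suc (2 ℕ.* k)

  Colour : Set
  Colour = Fin colours

  colour-injective : {a b : Colour} → colour k a ≡ colour k b → a ≡ b
  colour-injective {a} {b} eq = FinP.toℕ-injective (ℤP.+-injective (begin
    ℤ.+ toℕ a                        ≡⟨ minus-plus (ℤ.+ toℕ a) (ℤ.+ k) ⟨
    colour k a ℤ.+ ℤ.+ k             ≡⟨ cong (ℤ._+ ℤ.+ k) eq ⟩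
    colour k b ℤ.+ ℤ.+ k             ≡⟨ minus-plus (ℤ.+ toℕ b) (ℤ.+ k) ⟩
    ℤ.+ toℕ b                        ∎))
    where
    minus-plus : ∀ i j → i ℤ.- j ℤ.+ j ≡ i
    minus-plus = solve-∀

  colour-opposite : (a : Colour) → colour k (opposite a) ≡ ℤ.- colour k a
  colour-opposite a = begin
    ℤ.+ o ℤ.- ℤ.+ k                            ≡⟨ reflect (ℤ.+ t) (ℤ.+ o) (ℤ.+ k) ⟩
    (ℤ.+ t ℤ.+ ℤ.+ o) ℤ.- ℤ.+ t ℤ.- ℤ.+ k      ≡⟨ cong (λ s → s ℤ.- ℤ.+ t ℤ.- ℤ.+ k) t+o≡k+k ⟩
    (ℤ.+ k ℤ.+ ℤ.+ k) ℤ.- ℤ.+ t ℤ.- ℤ.+ k      ≡⟨ negate (ℤ.+ t) (ℤ.+ k) ⟩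
    ℤ.- (ℤ.+ t ℤ.- ℤ.+ k)                      ∎
    where
    t = toℕ a
    o = toℕ (opposite a)
    t+o≡k+k : ℤ.+ t ℤ.+ ℤ.+ o ≡ ℤ.+ k ℤ.+ ℤ.+ k
    t+o≡k+k = begin
      ℤ.+ t ℤ.+ ℤ.+ o          ≡⟨ ℤP.pos-+ t o ⟨
      ℤ.+ (t +ℕ o)             ≡⟨ cong (λ n → ℤ.+ (t +ℕ n)) (FinP.opposite-prop a) ⟩
      ℤ.+ (t +ℕ (2 ℕ.* k ∸ t)) ≡⟨ cong ℤ.+_ (ℕP.m+[n∸m]≡n (FinP.toℕ≤pred[n] a)) ⟩
      ℤ.+ (k +ℕ (k +ℕ 0))      ≡⟨ cong (λ n → ℤ.+ (k +ℕ n)) (ℕP.+-identityʳ k) ⟩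
      ℤ.+ (k +ℕ k)             ≡⟨ ℤP.pos-+ k k ⟩
      ℤ.+ k ℤ.+ ℤ.+ k          ∎
    reflect : ∀ i j l → j ℤ.- l ≡ (i ℤ.+ j) ℤ.- i ℤ.- l
    reflect = solve-∀
    negate : ∀ i l → (l ℤ.+ l) ℤ.- i ℤ.- l ≡ ℤ.- (i ℤ.- l)
    negate = solve-∀

  mid : Colour
  mid = fromℕ< (s≤s (ℕP.m≤m+n k (k +ℕ 0)))

  colour-mid : colour k mid ≡ ℤ.0ℤ
  colour-mid = trans (cong (λ n → ℤ.+ n ℤ.- ℤ.+ k) (FinP.toℕ-fromℕ< _)) (ℤP.+-inverseʳ (ℤ.+ k))

  properEdge : Sign → Colour → Colour → ℚ
  properEdge s a b = ⟦ ¬? (colour k a ℤ.≟ s · colour k b) ⟧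

  properEdge-pos : (a b : Colour) → properEdge pos a b ≡ 1ℚ - δ a b
  properEdge-pos a b = trans (⟦¬?⟧ (colour k a ℤ.≟ colour k b))
    (cong (_-_ 1ℚ) (⟦⟧-⇔ (mk⇔ colour-injective (cong (colour k))) (colour k a ℤ.≟ colour k b) (a FinP.≟ b)))

  properEdge-neg : (a b : Colour) → properEdge neg a b ≡ 1ℚ - δ b (opposite a)
  properEdge-neg a b = trans (⟦¬?⟧ (colour k a ℤ.≟ ℤ.- colour k b))
    (cong (_-_ 1ℚ) (⟦⟧-⇔ (mk⇔ antipodal⇒ antipodal⇐) (colour k a ℤ.≟ ℤ.- colour k b) (b FinP.≟ opposite a)))
    where
    antipodal⇒ : colour k a ≡ ℤ.- colour k b → b ≡ opposite a
    antipodal⇒ eq = colour-injective (begin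
      colour k b           ≡⟨ ℤP.neg-involutive (colour k b) ⟨
      ℤ.- ℤ.- colour k b   ≡⟨ cong ℤ.-_ eq ⟨
      ℤ.- colour k a       ≡⟨ colour-opposite a ⟨
      colour k (opposite a) ∎)
    antipodal⇐ : b ≡ opposite a → colour k a ≡ ℤ.- colour k b
    antipodal⇐ refl = sym (trans (cong ℤ.-_ (colour-opposite a)) (ℤP.neg-involutive (colour k a)))

  δ-opposite : (a : Colour) → δ (opposite a) a ≡ δ mid a
  δ-opposite a = ⟦⟧-⇔ (mk⇔ fixed⇒mid mid⇒fixed) (opposite a FinP.≟ a) (mid FinP.≟ a)
    where
    fixed⇒mid : opposite a ≡ a → mid ≡ a
    fixed⇒mid fixed = colour-injective (trans colour-mid
      (sym (i≡-i⇒i≡0 (trans (cong (colour k) (sym fixed)) (colour-opposite a)))))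
    mid⇒fixed : mid ≡ a → opposite a ≡ a
    mid⇒fixed refl = colour-injective (trans (colour-opposite mid) (trans (cong ℤ.-_ colour-mid) (sym colour-mid)))

  lam≢0 : lam k ≢ 0ℚ
  lam≢0 = ι-suc≢0 (2 ℕ.* k)

  lam-*-γ : (j : ℕ) → lam k * γ k (suc j) ≡ (lam k - 1ℚ) ^ j - (- 1ℚ) ^ j
  lam-*-γ j = *-÷₀ ((lam k - 1ℚ) ^ j - (- 1ℚ) ^ j) lam≢0

  γ-two : γ k 2 ≡ 1ℚ
  γ-two = ÷₀-unique lam≢0 (solve 1 (λ l → l :* con 1ℚ := (l :- con 1ℚ) :* con 1ℚ :- (:- con 1ℚ) :* con 1ℚ) refl (lam k))

  γ-suc : (j : ℕ) → γ k (suc (suc j)) ≡ (lam k - 1ℚ) * γ k (suc j) + (- 1ℚ) ^ j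
  γ-suc j = ÷₀-unique lam≢0 (begin
    l * ((l - 1ℚ) * γ k (suc j) + s)
      ≡⟨ solve 3 (λ l g s → l :* ((l :- con 1ℚ) :* g :+ s) := (l :- con 1ℚ) :* (l :* g) :+ l :* s) refl l (γ k (suc j)) s ⟩
    (l - 1ℚ) * (l * γ k (suc j)) + l * s
      ≡⟨ cong (λ y → (l - 1ℚ) * y + l * s) (lam-*-γ j) ⟩
    (l - 1ℚ) * ((l - 1ℚ) ^ j - s) + l * s
      ≡⟨ solve 3 (λ l p s → (l :- con 1ℚ) :* (p :- s) :+ l :* s := (l :- con 1ℚ) :* p :- (:- con 1ℚ) :* s) refl l ((l - 1ℚ) ^ j) s ⟩
    (l - 1ℚ) * (l - 1ℚ) ^ j - (- 1ℚ) * s ∎)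
    where
    l = lam k
    s = (- 1ℚ) ^ j

  γ-suc′ : (j : ℕ) → (lam k - 1ℚ) * γ k (suc j) ≡ γ k (suc (suc j)) - (- 1ℚ) ^ j
  γ-suc′ j = begin
    r                      ≡⟨ solve 2 (λ r s → r := r :+ s :- s) refl r s ⟩
    r + s - s              ≡⟨ cong (_- s) (γ-suc j) ⟨
    γ k (suc (suc j)) - s  ∎
    where
    r = (lam k - 1ℚ) * γ k (suc j)
    s = (- 1ℚ) ^ j

  [lam-1]*γ≢γ : (j : ℕ) → (lam k - 1ℚ) * γ k (suc j) ≢ γ k (suc (suc j))
  [lam-1]*γ≢γ j r≡q = -1^≢0 j (begin
    s                                ≡⟨ solve 2 (λ q s → s := q :- (q :- s)) refl q s ⟩
    q - (q - s)                      ≡⟨ cong (_-_ q) (γ-suc′ j) ⟨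
    q - (lam k - 1ℚ) * γ k (suc j)   ≡⟨ cong (_-_ q) r≡q ⟩
    q - q                            ≡⟨ ℚP.+-inverseʳ q ⟩
    0ℚ                               ∎)
    where
    q = γ k (suc (suc j))
    s = (- 1ℚ) ^ j

  properWalk : {L : ℕ} → Colour → Colour → Vec Colour L → ℚ
  properWalk a b []       = properEdge pos a b
  properWalk a b (w ∷ ws) = properEdge pos a w * properWalk w b ws

  -- Walks of length L + 1 from a to b in the complete graph on the colours.
  walks : ℕ → Colour → Colour → ℚ
  walks L a b = ∑ˡ (properWalk a b) (allMaps colours L)

  walks-suc : (L : ℕ) (a b : Colour) →
              walks (suc L) a b ≡ ∑[ w < colours ] (properEdge pos a w * walks L w b)
  walks-suc L a b = trans (∑-allMaps-suc colours L (properWalk a b))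
    (sum-cong-≗ (λ w → ∑ˡ-*ˡ (properEdge pos a w) (properWalk w b) (allMaps colours L)))

  walks-closed : (L : ℕ) (a b : Colour) → walks L a b ≡ γ k (suc (suc L)) - δ a b * (- 1ℚ) ^ L
  walks-closed zero a b = begin
    properEdge pos a b + 0ℚ  ≡⟨ ℚP.+-identityʳ (properEdge pos a b) ⟩
    properEdge pos a b       ≡⟨ properEdge-pos a b ⟩
    1ℚ - δ a b               ≡⟨ solve 2 (λ g d → g :- d := g :- d :* con 1ℚ) refl 1ℚ (δ a b) ⟩
    1ℚ - δ a b * 1ℚ          ≡⟨ cong (λ g → g - δ a b * 1ℚ) γ-two ⟨
    γ k 2 - δ a b * 1ℚ       ∎
  walks-closed (suc L) a b = begin
    walks (suc L) a b
      ≡⟨ walks-suc L a b ⟩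
    ∑[ w < colours ] (properEdge pos a w * walks L w b)
      ≡⟨ sum-cong-≗ affine ⟩
    ∑[ w < colours ] ((1ℚ + - 1ℚ * δ a w) * (g + - s * δ b w))
      ≡⟨ ∑-bilinear-δ a b 1ℚ (- 1ℚ) g (- s) ⟩
    lam k * 1ℚ * g + 1ℚ * - s + - 1ℚ * g + - 1ℚ * - s * δ a b
      ≡⟨ solve 4 (λ l g s d → l :* con 1ℚ :* g :+ con 1ℚ :* (:- s) :+ (:- con 1ℚ) :* g :+ (:- con 1ℚ) :* (:- s) :* d
                            := ((l :- con 1ℚ) :* g :+ (:- con 1ℚ) :* s) :- d :* ((:- con 1ℚ) :* s)) refl (lam k) g s (δ a b) ⟩
    ((lam k - 1ℚ) * g + - 1ℚ * s) - δ a b * (- 1ℚ * s)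
      ≡⟨ cong (λ y → y - δ a b * (- 1ℚ * s)) (γ-suc (suc L)) ⟨
    γ k (suc (suc (suc L))) - δ a b * (- 1ℚ) ^ suc L ∎
    where
    g = γ k (suc (suc L))
    s = (- 1ℚ) ^ L
    affine : ∀ w → properEdge pos a w * walks L w b ≡ (1ℚ + - 1ℚ * δ a w) * (g + - s * δ b w)
    affine w = begin
      properEdge pos a w * walks L w b   ≡⟨ cong₂ _*_ (properEdge-pos a w) (walks-closed L w b) ⟩
      (1ℚ - δ a w) * (g - δ w b * s)     ≡⟨ cong (λ d → (1ℚ - δ a w) * (g - d * s)) (δ-sym w b) ⟩
      (1ℚ - δ a w) * (g - δ b w * s)
        ≡⟨ solve 4 (λ g s p q → (con 1ℚ :- p) :* (g :- q :* s) := (con 1ℚ :+ (:- con 1ℚ) :* p) :* (g :+ (:- s) :* q)) refl g s (δ a w) (δ b w) ⟩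
      (1ℚ + - 1ℚ * δ a w) * (g + - s * δ b w) ∎

  edgeWeight : {N : ℕ} → Vec Colour N → Fin N × Fin N × Sign → ℚ
  edgeWeight c (x , y , s) = properEdge s (lookup c x) (lookup c y)

  ⟦proper?⟧ : (G : SignedGraph) (c : Vec Colour (V G)) → ⟦ proper? G k c ⟧ ≡ ∏ˡ (edgeWeight c) (edges G)
  ⟦proper?⟧ G c = ⟦all?⟧ _ (edges G)

  properWalk-tabulate : (L : ℕ) (b : Colour) (g : Fin (suc L) → Colour) →
    product (λ j → properEdge pos (g (inject₁ j)) (g (suc j))) * properEdge pos (g (fromℕ L)) b
      ≡ properWalk (g zero) b (Vec.tabulate (g ∘ suc))
  properWalk-tabulate zero    b g = ℚP.*-identityˡ (properEdge pos (g zero) b)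
  properWalk-tabulate (suc L) b g =
    trans (ℚP.*-assoc (properEdge pos (g zero) (g (suc zero))) _ _)
          (cong (properEdge pos (g zero) (g (suc zero)) *_) (properWalk-tabulate L b (g ∘ suc)))

  ∏-page : (L n : ℕ) (a b : Colour) (ws : Vec Colour (n ℕ.* suc L)) (i : Fin n) →
           ∏ˡ (edgeWeight (a ∷ b ∷ ws)) (pageEdges n (suc L) i) ≡ properWalk a b (block n i ws)
  ∏-page L n a b ws i = cong (properEdge pos a (g zero) *_) (begin
    ∏ˡ ω (map inner (allFin L) ++ last ∷ [])
      ≡⟨ Prodˡ.foldMap-++ ω (map inner (allFin L)) (last ∷ []) ⟩
    ∏ˡ ω (map inner (allFin L)) * (ω last * 1ℚ)
      ≡⟨ cong₂ _*_ (trans (Prodˡ.foldMap-map ω inner (allFin L)) (Prodˡ.foldMap-tabulate (ω ∘ inner) (λ j → j)))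
                   (ℚP.*-identityʳ (ω last)) ⟩
    product (λ j → properEdge pos (g (inject₁ j)) (g (suc j))) * properEdge pos (g (fromℕ L)) b
      ≡⟨ properWalk-tabulate L b g ⟩
    properWalk (g zero) b (Vec.tabulate (g ∘ suc)) ∎)
    where
    ω = edgeWeight (a ∷ b ∷ ws)
    g : Fin (suc L) → Colour
    g j = lookup ws (combine i j)
    inner : Fin L → Fin (2 +ℕ n ℕ.* suc L) × Fin (2 +ℕ n ℕ.* suc L) × Sign
    inner j = (bw n (suc L) i (inject₁ j) , bw n (suc L) i (suc j) , pos)
    last = (bw n (suc L) i (fromℕ L) , bv n (suc L) , pos)

  ⟦proper?⟧-book : (L n : ℕ) (a b : Colour) (ws : Vec Colour (n ℕ.* suc L)) →
    ⟦ proper? (signedBook (3 +ℕ L) n) k (a ∷ b ∷ ws) ⟧ ≡ properEdge neg a b * product (λ i → properWalk a b (block n i ws))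
  ⟦proper?⟧-book L n a b ws = trans (⟦proper?⟧ (signedBook (3 +ℕ L) n) (a ∷ b ∷ ws)) (cong (properEdge neg a b *_) (begin
    ∏ˡ ω (concatMap (pageEdges n (suc L)) (allFin n))   ≡⟨ Prodˡ.foldMap-concatMap ω (pageEdges n (suc L)) (allFin n) ⟩
    ∏ˡ (∏ˡ ω ∘ pageEdges n (suc L)) (allFin n)          ≡⟨ Prodˡ.foldMap-cong (∏-page L n a b ws) (allFin n) ⟩
    ∏ˡ (λ i → properWalk a b (block n i ws)) (allFin n) ≡⟨ Prodˡ.foldMap-tabulate (λ i → properWalk a b (block n i ws)) (λ i → i) ⟩
    product (λ i → properWalk a b (block n i ws))       ∎))
    where
    ω = edgeWeight (a ∷ b ∷ ws)

  χ-book-sum : (L n : ℕ) →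
    χℚ (signedBook (3 +ℕ L) n) k ≡ ∑[ a < colours ] ∑[ b < colours ] (properEdge neg a b * walks (suc L) a b ^ n)
  χ-book-sum L n = begin
    ι (length (filter (proper? G k) (allMaps colours (2 +ℕ N))))
      ≡⟨ ι-length-filter (proper? G k) (allMaps colours (2 +ℕ N)) ⟩
    ∑ˡ (λ c → ⟦ proper? G k c ⟧) (allMaps colours (2 +ℕ N))
      ≡⟨ ∑-allMaps-suc colours (suc N) (λ c → ⟦ proper? G k c ⟧) ⟩
    ∑[ a < colours ] ∑ˡ (λ v → ⟦ proper? G k (a ∷ v) ⟧) (allMaps colours (suc N))
      ≡⟨ sum-cong-≗ (λ a → ∑-allMaps-suc colours N (λ v → ⟦ proper? G k (a ∷ v) ⟧)) ⟩
    ∑[ a < colours ] ∑[ b < colours ] ∑ˡ (λ ws → ⟦ proper? G k (a ∷ b ∷ ws) ⟧) (allMaps colours N)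
      ≡⟨ sum-cong-≗ (λ a → sum-cong-≗ (λ b → pages a b)) ⟩
    ∑[ a < colours ] ∑[ b < colours ] (properEdge neg a b * walks (suc L) a b ^ n) ∎
    where
    G = signedBook (3 +ℕ L) n
    N = n ℕ.* suc L
    pages : ∀ a b → ∑ˡ (λ ws → ⟦ proper? G k (a ∷ b ∷ ws) ⟧) (allMaps colours N) ≡ properEdge neg a b * walks (suc L) a b ^ n
    pages a b = begin
      ∑ˡ (λ ws → ⟦ proper? G k (a ∷ b ∷ ws) ⟧) (allMaps colours N)
        ≡⟨ Sumˡ.foldMap-cong (⟦proper?⟧-book L n a b) (allMaps colours N) ⟩
      ∑ˡ (λ ws → properEdge neg a b * product (λ i → properWalk a b (block n i ws))) (allMaps colours N)
        ≡⟨ ∑ˡ-*ˡ (properEdge neg a b) _ (allMaps colours N) ⟩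
      properEdge neg a b * ∑ˡ (λ ws → product (λ i → properWalk a b (block n i ws))) (allMaps colours N)
        ≡⟨ cong (properEdge neg a b *_) (∑-blocks colours (suc L) n (properWalk a b)) ⟩
      properEdge neg a b * walks (suc L) a b ^ n ∎

  ∑∑-antipodal : (X Y : ℚ) →
    ∑[ a < colours ] ∑[ b < colours ] ((1ℚ + - 1ℚ * δ (opposite a) b) * (Y + (X - Y) * δ a b))
      ≡ (lam k - 1ℚ) * X + (lam k - 1ℚ) ^ 2 * Y
  ∑∑-antipodal X Y = begin
    ∑[ a < colours ] ∑[ b < colours ] ((1ℚ + - 1ℚ * δ (opposite a) b) * (Y + (X - Y) * δ a b))
      ≡⟨ sum-cong-≗ {colours} (λ a → ∑-bilinear-δ (opposite a) a 1ℚ (- 1ℚ) Y (X - Y)) ⟩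
    ∑[ a < colours ] (l * 1ℚ * Y + 1ℚ * (X - Y) + - 1ℚ * Y + - 1ℚ * (X - Y) * δ (opposite a) a)
      ≡⟨ sum-cong-≗ {colours} (λ a → cong (λ d → l * 1ℚ * Y + 1ℚ * (X - Y) + - 1ℚ * Y + - 1ℚ * (X - Y) * d) (δ-opposite a)) ⟩
    ∑[ a < colours ] (l * 1ℚ * Y + 1ℚ * (X - Y) + - 1ℚ * Y + - 1ℚ * (X - Y) * δ mid a)
      ≡⟨ ∑-affine-δ mid (l * 1ℚ * Y + 1ℚ * (X - Y) + - 1ℚ * Y) (- 1ℚ * (X - Y)) ⟩
    l * (l * 1ℚ * Y + 1ℚ * (X - Y) + - 1ℚ * Y) + - 1ℚ * (X - Y)
      ≡⟨ solve 3 (λ l X Y → l :* (l :* con 1ℚ :* Y :+ con 1ℚ :* (X :- Y) :+ (:- con 1ℚ) :* Y) :+ (:- con 1ℚ) :* (X :- Y)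
                          := (l :- con 1ℚ) :* X :+ (l :- con 1ℚ) :* ((l :- con 1ℚ) :* con 1ℚ) :* Y) refl l X Y ⟩
    (l - 1ℚ) * X + (l - 1ℚ) ^ 2 * Y ∎
    where
    l = lam k

  χ-book : (L n : ℕ) →
    χℚ (signedBook (3 +ℕ L) n) k ≡ (lam k - 1ℚ) * (γ k (3 +ℕ L) - (- 1ℚ) ^ suc L) ^ n + (lam k - 1ℚ) ^ 2 * γ k (3 +ℕ L) ^ n
  χ-book L n = begin
    χℚ (signedBook (3 +ℕ L) n) k
      ≡⟨ χ-book-sum L n ⟩
    ∑[ a < colours ] ∑[ b < colours ] (properEdge neg a b * walks (suc L) a b ^ n)
      ≡⟨ sum-cong-≗ (λ a → sum-cong-≗ (weight a)) ⟩
    ∑[ a < colours ] ∑[ b < colours ] ((1ℚ + - 1ℚ * δ (opposite a) b) * (G ^ n + ((G - s) ^ n - G ^ n) * δ a b))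
      ≡⟨ ∑∑-antipodal ((G - s) ^ n) (G ^ n) ⟩
    (lam k - 1ℚ) * (G - s) ^ n + (lam k - 1ℚ) ^ 2 * G ^ n ∎
    where
    G = γ k (3 +ℕ L)
    s = (- 1ℚ) ^ suc L
    weight : ∀ a b → properEdge neg a b * walks (suc L) a b ^ n
                     ≡ (1ℚ + - 1ℚ * δ (opposite a) b) * (G ^ n + ((G - s) ^ n - G ^ n) * δ a b)
    weight a b = begin
      properEdge neg a b * walks (suc L) a b ^ n
        ≡⟨ cong₂ _*_ (trans (properEdge-neg a b) (cong (_-_ 1ℚ) (δ-sym b (opposite a)))) (cong (_^ n) (walks-closed (suc L) a b)) ⟩
      (1ℚ - δ (opposite a) b) * (G - δ a b * s) ^ n
        ≡⟨ cong ((1ℚ - δ (opposite a) b) *_) (^-δ (a FinP.≟ b) G s n) ⟩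
      (1ℚ - δ (opposite a) b) * (G ^ n + δ a b * ((G - s) ^ n - G ^ n))
        ≡⟨ solve 4 (λ p q Y D → (con 1ℚ :- p) :* (Y :+ q :* D) := (con 1ℚ :+ (:- con 1ℚ) :* p) :* (Y :+ D :* q))
                   refl (δ (opposite a) b) (δ a b) (G ^ n) ((G - s) ^ n - G ^ n) ⟩
      (1ℚ + - 1ℚ * δ (opposite a) b) * (G ^ n + ((G - s) ^ n - G ^ n) * δ a b) ∎

  χ-book-one : (L : ℕ) → χℚ (signedBook (3 +ℕ L) 1) k ≡ (lam k - 1ℚ) ^ (3 +ℕ L)
  χ-book-one L = begin
    χℚ (signedBook (3 +ℕ L) 1) k
      ≡⟨ χ-book L 1 ⟩
    (l - 1ℚ) * ((G - - 1ℚ * t) * 1ℚ) + (l - 1ℚ) ^ 2 * (G * 1ℚ)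
      ≡⟨ solve 3 (λ l G t → (l :- con 1ℚ) :* ((G :- (:- con 1ℚ) :* t) :* con 1ℚ) :+ (l :- con 1ℚ) :* ((l :- con 1ℚ) :* con 1ℚ) :* (G :* con 1ℚ)
                          := (l :- con 1ℚ) :* (l :* G) :- (l :- con 1ℚ) :* ((:- con 1ℚ) :* t)) refl l G t ⟩
    (l - 1ℚ) * (l * G) - (l - 1ℚ) * (- 1ℚ * t)
      ≡⟨ cong (λ y → (l - 1ℚ) * y - (l - 1ℚ) * (- 1ℚ * t)) (lam-*-γ (2 +ℕ L)) ⟩
    (l - 1ℚ) * ((l - 1ℚ) ^ (2 +ℕ L) - (- 1ℚ) * (- 1ℚ * t)) - (l - 1ℚ) * (- 1ℚ * t)
      ≡⟨ solve 3 (λ l P t → (l :- con 1ℚ) :* (P :- (:- con 1ℚ) :* ((:- con 1ℚ) :* t)) :- (l :- con 1ℚ) :* ((:- con 1ℚ) :* t)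
                          := (l :- con 1ℚ) :* P) refl l ((l - 1ℚ) ^ (2 +ℕ L)) t ⟩
    (l - 1ℚ) ^ (3 +ℕ L) ∎
    where
    l = lam k
    G = γ k (3 +ℕ L)
    t = (- 1ℚ) ^ L

  book-recurrence : (L p : ℕ) →
    χℚ (signedBook (3 +ℕ L) (suc p)) k
      ≡ (lam k - 1ℚ) * γ k (2 +ℕ L) * χℚ (signedBook (3 +ℕ L) p) k + (- 1ℚ) ^ suc L * (lam k - 1ℚ) ^ 2 * γ k (3 +ℕ L) ^ p
  book-recurrence L p = begin
    χℚ (signedBook (3 +ℕ L) (suc p)) k
      ≡⟨ χ-book L (suc p) ⟩
    (l - 1ℚ) * ((G - s) * A) + (l - 1ℚ) ^ 2 * (G * B)
      ≡⟨ solve 5 (λ l G s A B → (l :- con 1ℚ) :* ((G :- s) :* A) :+ (l :- con 1ℚ) :* ((l :- con 1ℚ) :* con 1ℚ) :* (G :* B)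
                              := (G :- s) :* ((l :- con 1ℚ) :* A :+ (l :- con 1ℚ) :* ((l :- con 1ℚ) :* con 1ℚ) :* B)
                                 :+ s :* ((l :- con 1ℚ) :* ((l :- con 1ℚ) :* con 1ℚ)) :* B) refl l G s A B ⟩
    (G - s) * ((l - 1ℚ) * A + (l - 1ℚ) ^ 2 * B) + s * (l - 1ℚ) ^ 2 * B
      ≡⟨ cong₂ (λ r x → r * x + s * (l - 1ℚ) ^ 2 * B) (γ-suc′ (suc L)) (χ-book L p) ⟨
    (l - 1ℚ) * γ k (2 +ℕ L) * χℚ (signedBook (3 +ℕ L) p) k + s * (l - 1ℚ) ^ 2 * B ∎
    where
    l = lam k
    G = γ k (3 +ℕ L)
    s = (- 1ℚ) ^ suc L
    A = (G - s) ^ p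
    B = G ^ p

  book-closed-form : (L p : ℕ) →
    χℚ (signedBook (3 +ℕ L) (suc p)) k
      ≡ (lam k - 1ℚ) ^ (3 +ℕ L +ℕ suc p ∸ 1) * γ k (2 +ℕ L) ^ p
        + (- 1ℚ) ^ suc L * γ k (3 +ℕ L) * (lam k - 1ℚ) ^ 2
          * (((lam k - 1ℚ) ^ p * γ k (2 +ℕ L) ^ p - γ k (3 +ℕ L) ^ p)
             ÷₀ ((lam k - 1ℚ) * γ k (2 +ℕ L) - γ k (3 +ℕ L)))
  book-closed-form L p = begin
    x (suc p)
      ≡⟨ linear-recurrence x r (s * l₁ ^ 2) q (book-recurrence L ∘ suc) p ⟩
    r ^ p * x 1 + s * l₁ ^ 2 * q * geometric r q p
      ≡⟨ cong₂ (λ y g → r ^ p * y + s * l₁ ^ 2 * q * g) (χ-book-one L) (geometric≡÷₀ ([lam-1]*γ≢γ (suc L)) p) ⟩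
    r ^ p * l₁ ^ (3 +ℕ L) + s * l₁ ^ 2 * q * ((r ^ p - q ^ p) ÷₀ (r - q))
      ≡⟨ cong (λ y → y * l₁ ^ (3 +ℕ L) + s * l₁ ^ 2 * q * ((y - q ^ p) ÷₀ (r - q))) (^-distrib-* l₁ γ′ p) ⟩
    R * l₁ ^ (3 +ℕ L) + s * l₁ ^ 2 * q * ((R - q ^ p) ÷₀ (r - q))
      ≡⟨ cong₂ _+_ leading (solve 4 (λ s a q d → s :* a :* q :* d := s :* q :* a :* d) refl s (l₁ ^ 2) q ((R - q ^ p) ÷₀ (r - q))) ⟩
    l₁ ^ (3 +ℕ L +ℕ suc p ∸ 1) * γ′ ^ p + s * q * l₁ ^ 2 * ((R - q ^ p) ÷₀ (r - q)) ∎
    where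
    x : ℕ → ℚ
    x n = χℚ (signedBook (3 +ℕ L) n) k
    l₁ = lam k - 1ℚ
    γ′ = γ k (2 +ℕ L)
    q = γ k (3 +ℕ L)
    s = (- 1ℚ) ^ suc L
    r = l₁ * γ′
    R = l₁ ^ p * γ′ ^ p
    leading : R * l₁ ^ (3 +ℕ L) ≡ l₁ ^ (3 +ℕ L +ℕ suc p ∸ 1) * γ′ ^ p
    leading = begin
      l₁ ^ p * γ′ ^ p * l₁ ^ (3 +ℕ L)       ≡⟨ solve 3 (λ a g b → a :* g :* b := b :* a :* g) refl (l₁ ^ p) (γ′ ^ p) (l₁ ^ (3 +ℕ L)) ⟩
      l₁ ^ (3 +ℕ L) * l₁ ^ p * γ′ ^ p       ≡⟨ cong (_* γ′ ^ p) (^-homo-* l₁ (3 +ℕ L) p) ⟨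
      l₁ ^ (3 +ℕ L +ℕ p) * γ′ ^ p           ≡⟨ cong (λ e → l₁ ^ suc (suc e) * γ′ ^ p) (ℕP.+-suc L p) ⟨
      l₁ ^ (3 +ℕ L +ℕ suc p ∸ 1) * γ′ ^ p   ∎

theorem3p8 : (m n : ℕ) → 3 ≤ m → 2 ≤ n → (k : ℕ) →
    (χℚ (signedBook m n) k
       ≡ (lam k - 1ℚ) * γ k (m ∸ 1) * χℚ (signedBook m (n ∸ 1)) k
         + (- 1ℚ) ^ (m ∸ 2) * (lam k - 1ℚ) ^ 2 * γ k m ^ (n ∸ 1))
    × (χℚ (signedBook m n) k
       ≡ (lam k - 1ℚ) ^ (m +ℕ n ∸ 1) * γ k (m ∸ 1) ^ (n ∸ 1)
         + (- 1ℚ) ^ (m ∸ 2) * γ k m * (lam k - 1ℚ) ^ 2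
           * (((lam k - 1ℚ) ^ (n ∸ 1) * γ k (m ∸ 1) ^ (n ∸ 1) - γ k m ^ (n ∸ 1))
              ÷₀ ((lam k - 1ℚ) * γ k (m ∸ 1) - γ k m)))
theorem3p8 (suc (suc (suc L))) (suc (suc p)) (s≤s (s≤s (s≤s _))) (s≤s (s≤s _)) k =
  book-recurrence k L (suc p) , book-closed-form k L (suc p)
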